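{- Let $a\ge1,\alpha\ge1$ and $\beta,\gamma\ge0$ be integers, and for nonnegative integers $t,u$ set $b(t)=\alpha at+\beta$ and $N=N(t,u)=(\alpha at+\beta)(au+\gamma)+\alpha$. Suppose $x(t,u)=\frac{A}{a}N(t,u)+Cu+D$ for all $t,u$, where $A\in\mathbb Z$ and $C,D$ are rational constants. Then there exist constants $A_i,C_i,D_i$ ($i=1,2,3$), independent of $t$ and $u$, such that for all $t,u$ the numbers $$x-(A_1N+C_1u+D_1),\qquad a x-(A_2N+C_2u+D_2),\qquad b(t)x-(A_3N+C_3t+D_3)$$ all lie in $N\mathbb Z$; in particular $(|x|_N,|ax|_N,|b(t)x|_N)=(|A_1N+C_1u+D_1|_N,|A_2N+C_2u+D_2|_N,|A_3N+C_3t+D_3|_N)$.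
   Context: For a real $r$ and $N>0$, $|r|_N$ denotes the distance from $r$ to $N\mathbb Z$, i.e. $\min(r\bmod N,\,-r\bmod N)$. -}

module Defs where

open import Data.Nat as ℕ using (ℕ; NonZero)
open import Data.Integer as ℤ using (ℤ; +_)
open import Data.Rational using (ℚ; _/_; _+_; _*_; _-_; -_; floor; _⊓_)
open import Data.Product using (∃)
open import Relation.Binary.PropositionalEquality using (_≡_)

ℕ→ℚ : ℕ → ℚ
ℕ→ℚ n = + n / 1

ℤ→ℚ : ℤ → ℚ
ℤ→ℚ z = z / 1

InNℤ : ℕ → ℚ → Set
InNℤ N r = ∃ λ (k : ℤ) → r ≡ ℤ→ℚ k * ℕ→ℚ N

modℚ : ℚ → (N : ℕ) → .{{_ : NonZero N}} → ℚ
modℚ r N = r - ℕ→ℚ N * ℤ→ℚ (floor (r * ((+ 1) / N)))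

-- |r|_N = min (r mod N, -r mod N), the distance from r to N ℤ
distN : (N : ℕ) → .{{_ : NonZero N}} → ℚ → ℚ
distN N r = modℚ r N ⊓ modℚ (- r) N

bfun : ℕ → ℕ → ℕ → ℕ → ℕ
bfun a α β t = α ℕ.* a ℕ.* t ℕ.+ β

Nfun : ℕ → ℕ → ℕ → ℕ → ℕ → ℕ → ℕ
Nfun a α β γ t u = bfun a α β t ℕ.* (a ℕ.* u ℕ.+ γ) ℕ.+ α

-- N(t,u) ≥ α ≥ 1, so N is nonzero
Nfun-nonZero : ∀ a α β γ t u → .{{_ : NonZero α}} → NonZero (Nfun a α β γ t u)
Nfun-nonZero a (ℕ.suc α) β γ t u = ℕ.>-nonZero (Data.Nat.Properties.≤-trans (ℕ.s≤s ℕ.z≤n) (Data.Nat.Properties.m≤n+m (ℕ.suc α) _))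
  where import Data.Nat.Properties

-- x and a·x already have the required shape, with difference 0. For b·x, where b = b(t), the
-- only obstruction is the term b·C·u; writing C = a·c and using b·a·u = N − γ·b − α (the
-- definition of N) turns it into c·(N − γ·b − α), so b·x is α·A·t·N, a multiple of N, plus
-- an expression linear in N and t. Finally |·|_N only depends on the class modulo N, because
-- ⌊r + k⌋ = ⌊r⌋ + k for integral k.
module Submission where

open import Defs
open import Data.Nat as ℕ using (ℕ; NonZero; suc)
open import Data.Integer as ℤ using (ℤ; +_; +[1+_])
import Data.Nat.Properties as ℕₚ
import Data.Integer.Properties as ℤ
open import Data.Integer.DivMod using ([n/d]*d≤n; n<s[n/ℕd]*d; div-pos-is-/ℕ)
open import Data.Integer.Solver using (module +-*-Solver)
open import Data.Rational using (ℚ; _/_; _+_; _*_; _-_; -_; _⊓_; floor; mkℚ; toℚᵘ)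
open import Data.Rational.Properties
  using (toℚᵘ-injective; toℚᵘ-fromℚᵘ; toℚᵘ-homo-+; toℚᵘ-homo-*; toℚᵘ-homo‿-;
         +-inverseʳ; *-zeroˡ; *-identityʳ)
import Data.Rational.Solver as ℚ
import Data.Rational.Unnormalised as U
import Data.Rational.Unnormalised.Properties as U
open import Data.Product using (∃; _×_; _,_)
open import Relation.Binary.PropositionalEquality

module _ (e : ℕ) where
  private
    d : ℤ
    d = +[1+ e ]

  quotient-≤ : ∀ {n z₁ z₂} → z₁ ℤ.* d ℤ.≤ n → n ℤ.< ℤ.suc z₂ ℤ.* d → z₁ ℤ.≤ z₂
  quotient-≤ z₁d≤n n<[1+z₂]d = ℤ.≮⇒≥ λ z₂<z₁ → ℤ.<-irrefl refl
    (ℤ.<-≤-trans n<[1+z₂]d (ℤ.≤-trans (ℤ.*-monoʳ-≤-nonNeg d (ℤ.i<j⇒suc[i]≤j z₂<z₁)) z₁d≤n))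

  n<[1+n/d]*d : ∀ n → n ℤ.< ℤ.suc (n ℤ./ d) ℤ.* d
  n<[1+n/d]*d n = subst (λ q → n ℤ.< ℤ.suc q ℤ.* d) (sym (div-pos-is-/ℕ n (suc e))) (n<s[n/ℕd]*d n (suc e))

  /-unique : ∀ {n z} → z ℤ.* d ℤ.≤ n → n ℤ.< ℤ.suc z ℤ.* d → n ℤ./ d ≡ z
  /-unique {n} zd≤n n<[1+z]d =
    ℤ.≤-antisym (quotient-≤ ([n/d]*d≤n n d) n<[1+z]d) (quotient-≤ zd≤n (n<[1+n/d]*d n))

  [n+k*d]/d≡n/d+k : ∀ n k → (n ℤ.+ k ℤ.* d) ℤ./ d ≡ n ℤ./ d ℤ.+ k
  [n+k*d]/d≡n/d+k n k = /-unique lower upper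
    where
    open +-*-Solver
    q = n ℤ./ d
    lower : (q ℤ.+ k) ℤ.* d ℤ.≤ n ℤ.+ k ℤ.* d
    lower = subst (ℤ._≤ n ℤ.+ k ℤ.* d) (solve 3 (λ q k d → q :* d :+ k :* d := (q :+ k) :* d) refl q k d)
      (ℤ.+-monoˡ-≤ (k ℤ.* d) ([n/d]*d≤n n d))
    upper : n ℤ.+ k ℤ.* d ℤ.< ℤ.suc (q ℤ.+ k) ℤ.* d
    upper = subst (n ℤ.+ k ℤ.* d ℤ.<_)
      (solve 3 (λ q k d → (con (+ 1) :+ q) :* d :+ k :* d := (con (+ 1) :+ (q :+ k)) :* d) refl q k d)
      (ℤ.+-monoˡ-< (k ℤ.* d) (n<[1+n/d]*d n))

/-cross-cong : ∀ {n m} e e' → n ℤ.* +[1+ e' ] ≡ m ℤ.* +[1+ e ] → n ℤ./ +[1+ e ] ≡ m ℤ./ +[1+ e' ]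
/-cross-cong {n} {m} e e' nd'≡md = sym (/-unique e' lower upper)
  where
  open +-*-Solver
  d = +[1+ e ]
  d' = +[1+ e' ]
  q = n ℤ./ d
  lower : q ℤ.* d' ℤ.≤ m
  lower = ℤ.*-cancelʳ-≤-pos (q ℤ.* d') m d (begin
    q ℤ.* d' ℤ.* d  ≡⟨ solve 3 (λ q d d' → q :* d' :* d := q :* d :* d') refl q d d' ⟩
    q ℤ.* d ℤ.* d'  ≤⟨ ℤ.*-monoʳ-≤-nonNeg d' ([n/d]*d≤n n d) ⟩
    n ℤ.* d'        ≡⟨ nd'≡md ⟩
    m ℤ.* d         ∎)
    where open ℤ.≤-Reasoning
  upper : m ℤ.< ℤ.suc q ℤ.* d'
  upper = ℤ.*-cancelʳ-<-nonNeg d (begin-strict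
    m ℤ.* d              ≡⟨ sym nd'≡md ⟩
    n ℤ.* d'             <⟨ ℤ.*-monoʳ-<-pos d' (n<[1+n/d]*d e n) ⟩
    ℤ.suc q ℤ.* d ℤ.* d' ≡⟨ solve 3 (λ q d d' → (con (+ 1) :+ q) :* d :* d' := (con (+ 1) :+ q) :* d' :* d) refl q d d' ⟩
    ℤ.suc q ℤ.* d' ℤ.* d ∎)
    where open ℤ.≤-Reasoning

floorᵘ-cong : ∀ {p q} → p U.≃ q → U.floor p ≡ U.floor q
floorᵘ-cong {U.mkℚᵘ n e} {U.mkℚᵘ m e'} (U.*≡* cross) = /-cross-cong {n} {m} e e' cross

toℚᵘ-ℤ→ℚ : ∀ i → toℚᵘ (ℤ→ℚ i) U.≃ U.mkℚᵘ i 0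
toℚᵘ-ℤ→ℚ i = toℚᵘ-fromℚᵘ (U.mkℚᵘ i 0)

floor≡floorᵘ∘toℚᵘ : ∀ p → floor p ≡ U.floor (toℚᵘ p)
floor≡floorᵘ∘toℚᵘ (mkℚ _ _ _) = refl

floor-+-ℤ→ℚ : ∀ p k → floor (p + ℤ→ℚ k) ≡ floor p ℤ.+ k
floor-+-ℤ→ℚ p@(mkℚ n e _) k = begin
  floor (p + ℤ→ℚ k)                  ≡⟨ floor≡floorᵘ∘toℚᵘ (p + ℤ→ℚ k) ⟩
  U.floor (toℚᵘ (p + ℤ→ℚ k))         ≡⟨ floorᵘ-cong p+k≃[n+k*d]/d ⟩
  (n ℤ.+ k ℤ.* d) ℤ./ d              ≡⟨ [n+k*d]/d≡n/d+k e n k ⟩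
  n ℤ./ d ℤ.+ k                      ∎
  where
  open ≡-Reasoning
  open +-*-Solver
  d = +[1+ e ]
  cross : (n ℤ.* + 1 ℤ.+ k ℤ.* d) ℤ.* d ≡ (n ℤ.+ k ℤ.* d) ℤ.* + (suc e ℕ.* 1)
  cross = trans (solve 3 (λ n k d → (n :* con (+ 1) :+ k :* d) :* d := (n :+ k :* d) :* d) refl n k d)
                (cong (λ m → (n ℤ.+ k ℤ.* d) ℤ.* + m) (sym (ℕₚ.*-identityʳ (suc e))))
  p+k≃[n+k*d]/d : toℚᵘ (p + ℤ→ℚ k) U.≃ U.mkℚᵘ (n ℤ.+ k ℤ.* d) e
  p+k≃[n+k*d]/d = U.≃-trans (toℚᵘ-homo-+ p (ℤ→ℚ k))
    (U.≃-trans (U.+-cong (U.≃-refl {toℚᵘ p}) (toℚᵘ-ℤ→ℚ k)) (U.*≡* cross))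

ℤ→ℚ-+ : ∀ i j → ℤ→ℚ (i ℤ.+ j) ≡ ℤ→ℚ i + ℤ→ℚ j
ℤ→ℚ-+ i j = toℚᵘ-injective (begin
  toℚᵘ (ℤ→ℚ (i ℤ.+ j))             ≈⟨ toℚᵘ-ℤ→ℚ (i ℤ.+ j) ⟩
  U.mkℚᵘ (i ℤ.+ j) 0                ≈⟨ U.*≡* (solve 2 (λ i j → (i :+ j) :* con (+ 1) := (i :* con (+ 1) :+ j :* con (+ 1)) :* con (+ 1)) refl i j) ⟩
  U.mkℚᵘ i 0 U.+ U.mkℚᵘ j 0         ≈⟨ U.+-cong (toℚᵘ-ℤ→ℚ i) (toℚᵘ-ℤ→ℚ j) ⟨
  toℚᵘ (ℤ→ℚ i) U.+ toℚᵘ (ℤ→ℚ j)    ≈⟨ toℚᵘ-homo-+ (ℤ→ℚ i) (ℤ→ℚ j) ⟨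
  toℚᵘ (ℤ→ℚ i + ℤ→ℚ j)             ∎)
  where
  open U.≃-Reasoning
  open +-*-Solver

ℤ→ℚ-* : ∀ i j → ℤ→ℚ (i ℤ.* j) ≡ ℤ→ℚ i * ℤ→ℚ j
ℤ→ℚ-* i j = toℚᵘ-injective (begin
  toℚᵘ (ℤ→ℚ (i ℤ.* j))             ≈⟨ toℚᵘ-ℤ→ℚ (i ℤ.* j) ⟩
  U.mkℚᵘ i 0 U.* U.mkℚᵘ j 0         ≈⟨ U.*-cong (toℚᵘ-ℤ→ℚ i) (toℚᵘ-ℤ→ℚ j) ⟨
  toℚᵘ (ℤ→ℚ i) U.* toℚᵘ (ℤ→ℚ j)    ≈⟨ toℚᵘ-homo-* (ℤ→ℚ i) (ℤ→ℚ j) ⟨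
  toℚᵘ (ℤ→ℚ i * ℤ→ℚ j)             ∎)
  where open U.≃-Reasoning

ℤ→ℚ-neg : ∀ i → ℤ→ℚ (ℤ.- i) ≡ - ℤ→ℚ i
ℤ→ℚ-neg i = toℚᵘ-injective (begin
  toℚᵘ (ℤ→ℚ (ℤ.- i))  ≈⟨ toℚᵘ-ℤ→ℚ (ℤ.- i) ⟩
  U.- U.mkℚᵘ i 0       ≈⟨ U.-‿cong (toℚᵘ-ℤ→ℚ i) ⟨
  U.- toℚᵘ (ℤ→ℚ i)     ≈⟨ toℚᵘ-homo‿- (ℤ→ℚ i) ⟨
  toℚᵘ (- ℤ→ℚ i)       ∎)
  where open U.≃-Reasoning

ℕ→ℚ-+ : ∀ m n → ℕ→ℚ (m ℕ.+ n) ≡ ℕ→ℚ m + ℕ→ℚ n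
ℕ→ℚ-+ m n = ℤ→ℚ-+ (+ m) (+ n)

ℕ→ℚ-* : ∀ m n → ℕ→ℚ (m ℕ.* n) ≡ ℕ→ℚ m * ℕ→ℚ n
ℕ→ℚ-* m n = trans (cong ℤ→ℚ (ℤ.pos-* m n)) (ℤ→ℚ-* (+ m) (+ n))

n*[i/n]≡i : ∀ i n .{{_ : NonZero n}} → ℕ→ℚ n * (i / n) ≡ ℤ→ℚ i
n*[i/n]≡i i n@(suc e) = toℚᵘ-injective (begin
  toℚᵘ (ℕ→ℚ n * (i / n))            ≈⟨ toℚᵘ-homo-* (ℕ→ℚ n) (i / n) ⟩
  toℚᵘ (ℕ→ℚ n) U.* toℚᵘ (i / n)     ≈⟨ U.*-cong (toℚᵘ-ℤ→ℚ (+ n)) (toℚᵘ-fromℚᵘ (U.mkℚᵘ i e)) ⟩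
  U.mkℚᵘ (+ n) 0 U.* U.mkℚᵘ i e     ≈⟨ U.*≡* cross ⟩
  U.mkℚᵘ i 0                        ≈⟨ toℚᵘ-ℤ→ℚ i ⟨
  toℚᵘ (ℤ→ℚ i)                      ∎)
  where
  open U.≃-Reasoning
  open +-*-Solver
  cross : (+ n ℤ.* i) ℤ.* + 1 ≡ i ℤ.* + (1 ℕ.* n)
  cross = trans (solve 2 (λ n i → (n :* i) :* con (+ 1) := i :* n) refl (+ n) i)
                (cong (λ m → i ℤ.* + m) (sym (ℕₚ.+-identityʳ n)))

modℚ-periodic : ∀ N .{{_ : NonZero N}} r k → modℚ (r + ℤ→ℚ k * ℕ→ℚ N) N ≡ modℚ r N
modℚ-periodic N@(suc _) r k = begin
  r + K * Nq - Nq * ℤ→ℚ (floor ((r + K * Nq) * N⁻¹))  ≡⟨ cong (λ s → r + K * Nq - Nq * ℤ→ℚ (floor s)) [r+KN]/N≡r/N+K ⟩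
  r + K * Nq - Nq * ℤ→ℚ (floor (r * N⁻¹ + K))         ≡⟨ cong (λ z → r + K * Nq - Nq * ℤ→ℚ z) (floor-+-ℤ→ℚ (r * N⁻¹) k) ⟩
  r + K * Nq - Nq * ℤ→ℚ (F ℤ.+ k)                     ≡⟨ cong (λ z → r + K * Nq - Nq * z) (ℤ→ℚ-+ F k) ⟩
  r + K * Nq - Nq * (ℤ→ℚ F + K)                       ≡⟨ solve 4 (λ r K N F → r :+ K :* N :- N :* (F :+ K) := r :- N :* F) refl r K Nq (ℤ→ℚ F) ⟩
  r - Nq * ℤ→ℚ F                                      ∎
  where
  open ≡-Reasoning
  open ℚ.+-*-Solver
  K = ℤ→ℚ k
  Nq = ℕ→ℚ N
  N⁻¹ = + 1 / N
  F = floor (r * N⁻¹)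
  [r+KN]/N≡r/N+K : (r + K * Nq) * N⁻¹ ≡ r * N⁻¹ + K
  [r+KN]/N≡r/N+K = begin
    (r + K * Nq) * N⁻¹       ≡⟨ solve 4 (λ r K N N⁻¹ → (r :+ K :* N) :* N⁻¹ := r :* N⁻¹ :+ K :* (N :* N⁻¹)) refl r K Nq N⁻¹ ⟩
    r * N⁻¹ + K * (Nq * N⁻¹) ≡⟨ cong (λ z → r * N⁻¹ + K * z) (n*[i/n]≡i (+ 1) N) ⟩
    r * N⁻¹ + K * ℤ→ℚ (+ 1)  ≡⟨ cong (_+_ (r * N⁻¹)) (*-identityʳ K) ⟩
    r * N⁻¹ + K              ∎

distN-periodic : ∀ N .{{_ : NonZero N}} r k → distN N (r + ℤ→ℚ k * ℕ→ℚ N) ≡ distN N r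
distN-periodic N r k = cong₂ _⊓_ (modℚ-periodic N r k)
  (trans (cong (λ s → modℚ s N) -[r+kN]≡-r+[-k]N) (modℚ-periodic N (- r) (ℤ.- k)))
  where
  open ℚ.+-*-Solver
  -[r+kN]≡-r+[-k]N : - (r + ℤ→ℚ k * ℕ→ℚ N) ≡ - r + ℤ→ℚ (ℤ.- k) * ℕ→ℚ N
  -[r+kN]≡-r+[-k]N = trans (solve 3 (λ r k N → :- (r :+ k :* N) := :- r :+ (:- k) :* N) refl r (ℤ→ℚ k) (ℕ→ℚ N))
                           (cong (λ z → - r + z * ℕ→ℚ N) (sym (ℤ→ℚ-neg k)))

InNℤ-reflexive : ∀ N {r s} → r ≡ s → InNℤ N (r - s)
InNℤ-reflexive N {s = s} refl = + 0 , trans (+-inverseʳ s) (sym (*-zeroˡ (ℕ→ℚ N)))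

distN-cong : ∀ N .{{_ : NonZero N}} {r s} → InNℤ N (r - s) → distN N r ≡ distN N s
distN-cong N {r} {s} (k , r-s≡kN) = begin
  distN N r                        ≡⟨ cong (distN N) (solve 2 (λ r s → r := s :+ (r :- s)) refl r s) ⟩
  distN N (s + (r - s))            ≡⟨ cong (λ z → distN N (s + z)) r-s≡kN ⟩
  distN N (s + ℤ→ℚ k * ℕ→ℚ N)      ≡⟨ distN-periodic N s k ⟩
  distN N s                        ∎
  where
  open ≡-Reasoning
  open ℚ.+-*-Solver

ℕ→ℚ-bfun : ∀ a α β t → ℕ→ℚ (bfun a α β t) ≡ ℕ→ℚ α * ℕ→ℚ a * ℕ→ℚ t + ℕ→ℚ β
ℕ→ℚ-bfun a α β t = begin
  ℕ→ℚ (α ℕ.* a ℕ.* t ℕ.+ β)           ≡⟨ ℕ→ℚ-+ (α ℕ.* a ℕ.* t) β ⟩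
  ℕ→ℚ (α ℕ.* a ℕ.* t) + ℕ→ℚ β         ≡⟨ cong (_+ ℕ→ℚ β) (ℕ→ℚ-* (α ℕ.* a) t) ⟩
  ℕ→ℚ (α ℕ.* a) * ℕ→ℚ t + ℕ→ℚ β       ≡⟨ cong (λ z → z * ℕ→ℚ t + ℕ→ℚ β) (ℕ→ℚ-* α a) ⟩
  ℕ→ℚ α * ℕ→ℚ a * ℕ→ℚ t + ℕ→ℚ β       ∎
  where open ≡-Reasoning

ℕ→ℚ-Nfun : ∀ a α β γ t u →
  ℕ→ℚ (Nfun a α β γ t u) ≡ (ℕ→ℚ α * ℕ→ℚ a * ℕ→ℚ t + ℕ→ℚ β) * (ℕ→ℚ a * ℕ→ℚ u + ℕ→ℚ γ) + ℕ→ℚ α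
ℕ→ℚ-Nfun a α β γ t u = begin
  ℕ→ℚ (b ℕ.* (a ℕ.* u ℕ.+ γ) ℕ.+ α)               ≡⟨ ℕ→ℚ-+ (b ℕ.* (a ℕ.* u ℕ.+ γ)) α ⟩
  ℕ→ℚ (b ℕ.* (a ℕ.* u ℕ.+ γ)) + ℕ→ℚ α             ≡⟨ cong (_+ ℕ→ℚ α) (ℕ→ℚ-* b (a ℕ.* u ℕ.+ γ)) ⟩
  ℕ→ℚ b * ℕ→ℚ (a ℕ.* u ℕ.+ γ) + ℕ→ℚ α             ≡⟨ cong (λ z → ℕ→ℚ b * z + ℕ→ℚ α) (ℕ→ℚ-+ (a ℕ.* u) γ) ⟩
  ℕ→ℚ b * (ℕ→ℚ (a ℕ.* u) + ℕ→ℚ γ) + ℕ→ℚ α         ≡⟨ cong₂ (λ y z → y * (z + ℕ→ℚ γ) + ℕ→ℚ α) (ℕ→ℚ-bfun a α β t) (ℕ→ℚ-* a u) ⟩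
  (ℕ→ℚ α * ℕ→ℚ a * ℕ→ℚ t + ℕ→ℚ β) * (ℕ→ℚ a * ℕ→ℚ u + ℕ→ℚ γ) + ℕ→ℚ α ∎
  where
  open ≡-Reasoning
  b = bfun a α β t

b*x-expansion : ∀ a α β γ t u K c D →
  let b = α * a * t + β
      N = b * (a * u + γ) + α
  in b * (K * N + (a * c) * u + D) - ((β * K + c) * N + (α * a * D - c * γ * α * a) * t + (D * β - c * α - c * γ * β))
     ≡ (α * (a * K) * t) * N
b*x-expansion = solve 9 (λ a α β γ t u K c D →
  let b = α :* a :* t :+ β
      N = b :* (a :* u :+ γ) :+ α
  in b :* (K :* N :+ (a :* c) :* u :+ D) :- ((β :* K :+ c) :* N :+ (α :* a :* D :- c :* γ :* α :* a) :* t :+ (D :* β :- c :* α :- c :* γ :* β))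
     := (α :* (a :* K) :* t) :* N) refl
  where open ℚ.+-*-Solver

bfun*x-congruence : ∀ a α β γ t u (A : ℤ) (K c D : ℚ) → ℕ→ℚ a * K ≡ ℤ→ℚ A →
  let aq = ℕ→ℚ a
      αq = ℕ→ℚ α
      βq = ℕ→ℚ β
      γq = ℕ→ℚ γ
      Nq = ℕ→ℚ (Nfun a α β γ t u)
  in InNℤ (Nfun a α β γ t u) (ℕ→ℚ (bfun a α β t) * (K * Nq + (aq * c) * ℕ→ℚ u + D)
       - ((βq * K + c) * Nq + (αq * aq * D - c * γq * αq * aq) * ℕ→ℚ t + (D * βq - c * αq - c * γq * βq)))
bfun*x-congruence a α β γ t u A K c D a*K≡A = + α ℤ.* A ℤ.* + t , (begin
    ℕ→ℚ (bfun a α β t) * (K * Nq + (aq * c) * uq + D) - (A₃ * Nq + C₃ * tq + D₃)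
      ≡⟨ cong₂ (λ b n → b * (K * n + (aq * c) * uq + D) - (A₃ * n + C₃ * tq + D₃))
               (ℕ→ℚ-bfun a α β t) (ℕ→ℚ-Nfun a α β γ t u) ⟩
    b * (K * N + (aq * c) * uq + D) - (A₃ * N + C₃ * tq + D₃)
      ≡⟨ b*x-expansion aq αq βq γq tq uq K c D ⟩
    αq * (aq * K) * tq * N
      ≡⟨ cong₂ (λ z n → αq * z * tq * n) a*K≡A (sym (ℕ→ℚ-Nfun a α β γ t u)) ⟩
    αq * ℤ→ℚ A * tq * Nq
      ≡⟨ cong (λ z → z * tq * Nq) (ℤ→ℚ-* (+ α) A) ⟨
    ℤ→ℚ (+ α ℤ.* A) * tq * Nq
      ≡⟨ cong (_* Nq) (ℤ→ℚ-* (+ α ℤ.* A) (+ t)) ⟨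
    ℤ→ℚ (+ α ℤ.* A ℤ.* + t) * Nq   ∎)
  where
  open ≡-Reasoning
  aq = ℕ→ℚ a
  αq = ℕ→ℚ α
  βq = ℕ→ℚ β
  γq = ℕ→ℚ γ
  Nq = ℕ→ℚ (Nfun a α β γ t u)
  tq = ℕ→ℚ t
  uq = ℕ→ℚ u
  A₃ = βq * K + c
  C₃ = αq * aq * D - c * γq * αq * aq
  D₃ = D * βq - c * αq - c * γq * βq
  b = αq * aq * tq + βq
  N = b * (aq * uq + γq) + αq

lemma4p16 : (a α β γ : ℕ) → .{{_ : NonZero a}} → .{{_ : NonZero α}}
  → (A : ℤ) (C D : ℚ) (x : ℕ → ℕ → ℚ)
  → (∀ t u → x t u ≡ (A / a) * ℕ→ℚ (Nfun a α β γ t u) + C * ℕ→ℚ u + D)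
  → ∃ λ (A₁ : ℚ) → ∃ λ (C₁ : ℚ) → ∃ λ (D₁ : ℚ)
  → ∃ λ (A₂ : ℚ) → ∃ λ (C₂ : ℚ) → ∃ λ (D₂ : ℚ)
  → ∃ λ (A₃ : ℚ) → ∃ λ (C₃ : ℚ) → ∃ λ (D₃ : ℚ)
  → ∀ t u →
    let N = Nfun a α β γ t u
        instance _ = Nfun-nonZero a α β γ t u
        y₁ = A₁ * ℕ→ℚ N + C₁ * ℕ→ℚ u + D₁
        y₂ = A₂ * ℕ→ℚ N + C₂ * ℕ→ℚ u + D₂
        y₃ = A₃ * ℕ→ℚ N + C₃ * ℕ→ℚ t + D₃
    in (InNℤ N (x t u - y₁)
        × InNℤ N (ℕ→ℚ a * x t u - y₂)
        × InNℤ N (ℕ→ℚ (bfun a α β t) * x t u - y₃))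
       × (distN N (x t u) ≡ distN N y₁
        × distN N (ℕ→ℚ a * x t u) ≡ distN N y₂
        × distN N (ℕ→ℚ (bfun a α β t) * x t u) ≡ distN N y₃)
lemma4p16 a α β γ A C D x hx =
  K , C , D , aq * K , aq * C , aq * D , A₃ , C₃ , D₃ ,
  λ t u → let N = Nfun a α β γ t u
              instance _ = Nfun-nonZero a α β γ t u
          in (InNℤ-reflexive N (hx t u) , InNℤ-reflexive N (a*x≡y₂ t u) , b*x≡y₃ t u) ,
             (cong (distN N) (hx t u) , cong (distN N) (a*x≡y₂ t u) ,
              distN-cong N {ℕ→ℚ (bfun a α β t) * x t u} {y₃ t u} (b*x≡y₃ t u))
  where
  open ℚ.+-*-Solver
  aq = ℕ→ℚ a
  αq = ℕ→ℚ α
  βq = ℕ→ℚ β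
  γq = ℕ→ℚ γ
  K = A / a
  c = C * (+ 1 / a)
  A₃ = βq * K + c
  C₃ = αq * aq * D - c * γq * αq * aq
  D₃ = D * βq - c * αq - c * γq * βq
  y₃ : ℕ → ℕ → ℚ
  y₃ t u = A₃ * ℕ→ℚ (Nfun a α β γ t u) + C₃ * ℕ→ℚ t + D₃
  C≡a*c : C ≡ aq * c
  C≡a*c = begin
    C                    ≡⟨ sym (*-identityʳ C) ⟩
    C * ℤ→ℚ (+ 1)        ≡⟨ cong (C *_) (sym (n*[i/n]≡i (+ 1) a)) ⟩
    C * (aq * (+ 1 / a)) ≡⟨ solve 3 (λ C a a⁻¹ → C :* (a :* a⁻¹) := a :* (C :* a⁻¹)) refl C aq (+ 1 / a) ⟩
    aq * c               ∎
    where open ≡-Reasoning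
  a*x≡y₂ : ∀ t u → aq * x t u ≡ aq * K * ℕ→ℚ (Nfun a α β γ t u) + aq * C * ℕ→ℚ u + aq * D
  a*x≡y₂ t u = trans (cong (aq *_) (hx t u))
    (solve 6 (λ a K N C u D → a :* (K :* N :+ C :* u :+ D) := a :* K :* N :+ a :* C :* u :+ a :* D)
       refl aq K (ℕ→ℚ (Nfun a α β γ t u)) C (ℕ→ℚ u) D)
  b*x≡y₃ : ∀ t u → InNℤ (Nfun a α β γ t u) (ℕ→ℚ (bfun a α β t) * x t u - y₃ t u)
  b*x≡y₃ t u = subst (λ z → InNℤ (Nfun a α β γ t u) (ℕ→ℚ (bfun a α β t) * z - y₃ t u))
    (sym (trans (hx t u) (cong (λ C → K * ℕ→ℚ (Nfun a α β γ t u) + C * ℕ→ℚ u + D) C≡a*c)))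
    (bfun*x-congruence a α β γ t u A K c D (n*[i/n]≡i A a))
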